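{- Let $\mathbb{F}_q$ be a finite field and let $k,t,n$ be integers with $0\le t\le k$ and $(n-1)(k-t)\le k$. Let $\epsilon,\eta$ be integers with $0\le\epsilon\le k-t$ and $2\le\eta\le n-1$. Then there exist a vector space $\mathcal{V}$ over $\mathbb{F}_q$ and a $(k,k-t)$-SCID $\{\pi_1,\ldots,\pi_n\}$ in $\mathcal{V}$ with $n$ elements such that \[\dim S+\dim I=nk-(\eta-2)(k-t)-\epsilon,\] where $S:=\langle\pi_1,\ldots,\pi_n\rangle$ and $I:=\langle \pi_i\cap\pi_j\mid i\neq j\rangle$.
   Context: A $(k,k-t)$-SCID is a set of (distinct) $k$-dimensional subspaces of a vector space, containing at least two elements, such that any two distinct members intersect in a subspace of dimension exactly $k-t$. $\langle\cdot\rangle$ denotes the span. The dimension of the ambient vector space is not fixed in advance. -}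

module Defs where

open import Level using (Level; _⊔_) renaming (suc to lsuc)
open import Data.Nat using (ℕ; zero; suc; _∸_)
open import Data.Fin using (Fin; zero; suc)
open import Data.Product using (Σ; ∃; _×_; _,_)
open import Relation.Nullary using (¬_)
open import Relation.Binary.PropositionalEquality using (_≡_)
open import Algebra.Bundles using (CommutativeRing)

record FiniteField (c ℓ : Level) : Set (lsuc (c ⊔ ℓ)) where
  field
    commRing : CommutativeRing c ℓ
  open CommutativeRing commRing public
  field
    0≉1     : ¬ (0# ≈ 1#)
    inverse : ∀ x → ¬ (x ≈ 0#) → ∃ λ y → (x * y) ≈ 1#
    size    : ℕ
    enum    : Fin size → Carrier
    enum-surjective : ∀ x → ∃ λ i → enum i ≈ x

module LinearAlgebra {c ℓ : Level} (F : FiniteField c ℓ) where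
  open FiniteField F using (Carrier; _≈_; _+_; _*_; 0#; 1#)

  Vector : ℕ → Set c
  Vector m = Fin m → Carrier

  _≈ᵥ_ : ∀ {m} → Vector m → Vector m → Set ℓ
  u ≈ᵥ v = ∀ a → u a ≈ v a

  0ᵥ : ∀ {m} → Vector m
  0ᵥ a = 0#

  _+ᵥ_ : ∀ {m} → Vector m → Vector m → Vector m
  (u +ᵥ v) a = u a + v a

  _·_ : ∀ {m} → Carrier → Vector m → Vector m
  (x · v) a = x * v a

  lincomb : ∀ {m r} → (Fin r → Carrier) → (Fin r → Vector m) → Vector m
  lincomb {r = zero}  coef vec = 0ᵥ
  lincomb {r = suc r} coef vec =
    (coef zero · vec zero) +ᵥ lincomb (λ i → coef (suc i)) (λ i → vec (suc i))

  VSet : ℕ → Set (lsuc (c ⊔ ℓ))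
  VSet m = Vector m → Set (c ⊔ ℓ)

  Span : ∀ {m} → VSet m → VSet m
  Span {m} P x = ∃ λ (r : ℕ) → Σ (Fin r → Vector m) λ vec →
                 (∀ i → P (vec i)) × ∃ λ coef → lincomb coef vec ≈ᵥ x

  _∩_ : ∀ {m} → VSet m → VSet m → VSet m
  (P ∩ Q) x = P x × Q x

  LinearlyIndependent : ∀ {m r} → (Fin r → Vector m) → Set (c ⊔ ℓ)
  LinearlyIndependent vec =
    ∀ coef → lincomb coef vec ≈ᵥ 0ᵥ → ∀ i → coef i ≈ 0#

  record IsSubspace {m} (W : VSet m) : Set (c ⊔ ℓ) where
    field
      resp  : ∀ {u v} → u ≈ᵥ v → W u → W v
      has-0 : W 0ᵥ
      +-closed : ∀ {u v} → W u → W v → W (u +ᵥ v)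
      ·-closed : ∀ x {v} → W v → W (x · v)

  HasDim : ∀ {m} → VSet m → ℕ → Set (c ⊔ ℓ)
  HasDim {m} W d = Σ (Fin d → Vector m) λ b →
    LinearlyIndependent b × (∀ i → W (b i)) ×
    (∀ x → W x → ∃ λ coef → lincomb coef b ≈ᵥ x)

  SameSet : ∀ {m} → VSet m → VSet m → Set (c ⊔ ℓ)
  SameSet P Q = ∀ x → (P x → Q x) × (Q x → P x)

  -- a family π₁,…,π_n of pairwise distinct k-dimensional subspaces of F^m,
  -- any two distinct members meeting in a subspace of dimension exactly k - t
  -- (n ≥ 2 is required separately where needed)
  IsSCIDFamily : ∀ {m n} → (k t : ℕ) → (Fin n → VSet m) → Set (c ⊔ ℓ)
  IsSCIDFamily k t π =
    (∀ i → IsSubspace (π i) × HasDim (π i) k) ×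
    (∀ i j → ¬ (i ≡ j) → ¬ SameSet (π i) (π j) × HasDim (π i ∩ π j) (k ∸ t))

  SpanAll : ∀ {m n} → (Fin n → VSet m) → VSet m
  SpanAll π = Span (λ x → ∃ λ i → π i x)

  SpanIntersections : ∀ {m n} → (Fin n → VSet m) → VSet m
  SpanIntersections π = Span (λ x → ∃ λ i → ∃ λ j → ¬ (i ≡ j) × (π i ∩ π j) x)

-- Use coordinate subspaces. A family ℬ of subsets of {0, …, n-1}, indexed by the
-- coordinates x < m, determines π_i = ⟨e_x | i ∈ ℬ_x⟩ ≤ F^m. Then dim π_i is the number of
-- members containing i, dim (π_i ∩ π_j) the number containing both, S is spanned by the
-- e_x with ℬ_x ≠ ∅ and I by those with |ℬ_x| ≥ 2. When every point lies in k members,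
-- Σ_x |ℬ_x| = nk, so dim S + dim I = nk - Σ_x (|ℬ_x| - 2)₊.
--
-- It remains to find a family in which every point lies in k members, every pair in
-- d = k - t members, and Σ_x (|ℬ_x| - 2)₊ = (η - 2) d + ε. Take d levels, the r-th made of
-- the block {0, …, s_r - 1}, s_r = η + [r < ε], and of every pair not inside that block:
-- each pair of points lies in exactly one member of a level, each point in at most n - 1
-- of them, and the level contributes s_r - 2. Since (n - 1) d ≤ k, singletons then bring
-- every point up to exactly k members.

module Submission where

open import Defs
open import Level using (Level; Lift; lift; _⊔_)
open import Data.Bool using (Bool; true; false; T; _∧_; _∨_)
open import Data.Bool.Properties using (T-∧; T-∨; ∧-comm)
open import Data.Empty using (⊥-elim)
open import Data.Fin using (Fin; zero; suc; toℕ; splitAt)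
open import Data.Fin.Properties using (_≟_)
import Data.Fin.Properties as Finₚ
open import Data.Nat using (ℕ; zero; suc; _+_; _*_; _∸_; _≤_; _<_; _≤ᵇ_; _<ᵇ_; _<?_; z≤n; s≤s; s≤s⁻¹)
open import Data.Nat.Properties
  using ( +-assoc; +-comm; +-identityʳ; *-comm; *-zeroʳ; *-identityʳ; +-mono-≤; +-monoˡ-≤; +-monoʳ-≤
        ; ≤-refl; ≤-reflexive; ≤-trans; ≤-antisym; <-irrefl; <-asym; <-trans; <⇒≤; <⇒≱; ≮⇒≥
        ; m≤m+n; m≤n+m; m∸n≤m; m∸n+n≡m; m+[n∸m]≡n; m≤n⇒m∸n≡0; +-∸-comm; ∸-monoʳ-<
        ; <ᵇ⇒<; <⇒<ᵇ; ≤ᵇ⇒≤; ≤⇒≤ᵇ; +-0-commutativeMonoid; module ≤-Reasoning )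
open import Data.Product using (Σ; ∃; _×_; _,_; proj₁; proj₂) renaming (map to Σ-map)
open import Data.Sum using (_⊎_; inj₁; inj₂) renaming (map to ⊎-map)
open import Data.Vec.Functional using (Vector; map; _++_; concat; []; _∷_)
open import Function using (_∘_; id; case_of_; Equivalence)
open import Relation.Nullary using (¬_; yes; no)
open import Relation.Nullary.Decidable using (⌊_⌋; toWitness; fromWitness; T?)
open import Relation.Binary.PropositionalEquality
  using (_≡_; _≢_; refl; sym; trans; cong; cong₂; subst; subst₂; module ≡-Reasoning)
open import Relation.Binary using (tri<; tri≈; tri>)
open import Algebra.Properties.CommutativeMonoid.Sum +-0-commutativeMonoid
  using (sum; sum-cong-≗; ∑-distrib-+; ∑-comm)

open Equivalence using (to; from)

private
  variable
    A : Set
    m n : ℕ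

-- Finite sums and counting over Fin

∑-++ : (h : A → ℕ) (xs : Vector A m) (ys : Vector A n) →
       sum (map h (xs ++ ys)) ≡ sum (map h xs) + sum (map h ys)
∑-++ {m = zero}  h xs ys = refl
∑-++ {m = suc m} h xs ys = begin
  h (xs zero) + sum (map h ((xs ++ ys) ∘ suc))          ≡⟨ cong (h (xs zero) +_) (sum-cong-≗ (cong h ∘ ++-suc)) ⟩
  h (xs zero) + sum (map h ((xs ∘ suc) ++ ys))          ≡⟨ cong (h (xs zero) +_) (∑-++ h (xs ∘ suc) ys) ⟩
  h (xs zero) + (sum (map h xs ∘ suc) + sum (map h ys)) ≡⟨ +-assoc (h (xs zero)) _ _ ⟨
  sum (map h xs) + sum (map h ys)                       ∎
  where
  open ≡-Reasoning
  ++-suc : ∀ i → (xs ++ ys) (suc i) ≡ ((xs ∘ suc) ++ ys) i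
  ++-suc i with splitAt m i
  ... | inj₁ _ = refl
  ... | inj₂ _ = refl

∑-concat : (h : A → ℕ) (xss : Vector (Vector A m) n) →
           sum (map h (concat xss)) ≡ sum (λ a → sum (map h (xss a)))
∑-concat {n = zero}      h xss = refl
∑-concat {m = m} {suc n} h xss = begin
  sum (map h (concat xss))
    ≡⟨ sum-cong-≗ (cong h ∘ concat-suc) ⟩
  sum (map h (xss zero ++ concat (xss ∘ suc)))
    ≡⟨ ∑-++ h (xss zero) (concat (xss ∘ suc)) ⟩
  sum (map h (xss zero)) + sum (map h (concat (xss ∘ suc)))
    ≡⟨ cong (sum (map h (xss zero)) +_) (∑-concat h (xss ∘ suc)) ⟩
  sum (λ a → sum (map h (xss a))) ∎
  where
  open ≡-Reasoning
  concat-suc : ∀ i → concat xss i ≡ (xss zero ++ concat (xss ∘ suc)) i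
  concat-suc i with splitAt m i
  ... | inj₁ _ = refl
  ... | inj₂ _ = refl

∑-const : ∀ n c → sum {n} (λ _ → c) ≡ n * c
∑-const zero    c = refl
∑-const (suc n) c = cong (c +_) (∑-const n c)

∑-zero : (f : Vector ℕ n) → (∀ a → f a ≡ 0) → sum f ≡ 0
∑-zero {n} f f≡0 = trans (sum-cong-≗ f≡0) (trans (∑-const n 0) (*-zeroʳ n))

∑-mono-≤ : {f g : Vector ℕ n} → (∀ a → f a ≤ g a) → sum f ≤ sum g
∑-mono-≤ {zero}  f≤g = z≤n
∑-mono-≤ {suc n} f≤g = +-mono-≤ (f≤g zero) (∑-mono-≤ (f≤g ∘ suc))

∑-δ : (f : Vector ℕ n) (i : Fin n) → (∀ a → a ≢ i → f a ≡ 0) → sum f ≡ f i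
∑-δ f zero    f≡0 = trans (cong (f zero +_) (∑-zero (f ∘ suc) (λ a → f≡0 (suc a) λ ()))) (+-identityʳ _)
∑-δ f (suc i) f≡0 = trans (cong (_+ sum (f ∘ suc)) (f≡0 zero λ ()))
                          (∑-δ (f ∘ suc) i (λ a a≢i → f≡0 (suc a) (a≢i ∘ Finₚ.suc-injective)))

T∧⇒Tˡ : ∀ {p q} → T (p ∧ q) → T p
T∧⇒Tˡ = proj₁ ∘ to T-∧

T∧⇒Tʳ : ∀ {p q} → T (p ∧ q) → T q
T∧⇒Tʳ = proj₂ ∘ to T-∧

T×T⇒T∧ : ∀ {p q} → T p → T q → T (p ∧ q)
T×T⇒T∧ p q = from T-∧ (p , q)

𝟙 : Bool → ℕ
𝟙 true  = 1
𝟙 false = 0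

𝟙≤1 : ∀ b → 𝟙 b ≤ 1
𝟙≤1 true  = ≤-refl
𝟙≤1 false = z≤n

𝟙-¬T : ∀ {b} → ¬ T b → 𝟙 b ≡ 0
𝟙-¬T {true}  ¬b = ⊥-elim (¬b _)
𝟙-¬T {false} ¬b = refl

𝟙-mono : ∀ {a b} → (T a → T b) → 𝟙 a ≤ 𝟙 b
𝟙-mono {true}  {true}  a⇒b = ≤-refl
𝟙-mono {true}  {false} a⇒b = ⊥-elim (a⇒b _)
𝟙-mono {false}         a⇒b = z≤n

𝟙-cong : ∀ {a b} → (T a → T b) → (T b → T a) → 𝟙 a ≡ 𝟙 b
𝟙-cong a⇒b b⇒a = ≤-antisym (𝟙-mono a⇒b) (𝟙-mono b⇒a)

𝟙-∨ : ∀ a b → 𝟙 (a ∨ b) ≤ 𝟙 a + 𝟙 b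
𝟙-∨ true  b = s≤s z≤n
𝟙-∨ false b = ≤-refl

𝟙-∨-∧ : ∀ p q r → 𝟙 ((p ∨ q) ∧ r) ≤ 𝟙 (p ∧ r) + 𝟙 (q ∧ r)
𝟙-∨-∧ true  q r = m≤m+n (𝟙 r) _
𝟙-∨-∧ false q r = ≤-refl

<ᵇ-suc : ∀ q t → (q <ᵇ suc t) ≡ (q ≤ᵇ t)
<ᵇ-suc zero    t = refl
<ᵇ-suc (suc q) t = refl

𝟙-≤ᵇ+𝟙-<ᵇ : ∀ s t → 𝟙 (s ≤ᵇ t) + 𝟙 (t <ᵇ s) ≡ 1
𝟙-≤ᵇ+𝟙-<ᵇ zero    t       = refl
𝟙-≤ᵇ+𝟙-<ᵇ (suc s) zero    = refl
𝟙-≤ᵇ+𝟙-<ᵇ (suc s) (suc t) = trans (cong (λ b → 𝟙 b + 𝟙 (t <ᵇ s)) (<ᵇ-suc s t)) (𝟙-≤ᵇ+𝟙-<ᵇ s t)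

count : (Fin m → Bool) → ℕ
count A = sum (map 𝟙 A)

count-mono : {A B : Fin m → Bool} → (∀ x → T (A x) → T (B x)) → count A ≤ count B
count-mono A⇒B = ∑-mono-≤ (λ x → 𝟙-mono (A⇒B x))

count-cong : {A B : Fin m → Bool} → (∀ x → T (A x) → T (B x)) → (∀ x → T (B x) → T (A x)) →
             count A ≡ count B
count-cong A⇒B B⇒A = ≤-antisym (count-mono A⇒B) (count-mono B⇒A)

count-∨ : (A B : Fin m → Bool) → count (λ x → A x ∨ B x) ≤ count A + count B
count-∨ A B = ≤-trans (∑-mono-≤ (λ x → 𝟙-∨ (A x) (B x))) (≤-reflexive (∑-distrib-+ (map 𝟙 A) (map 𝟙 B)))

⁅_⁆ : Fin n → Fin n → Bool
⁅ a ⁆ x = ⌊ x ≟ a ⌋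

⁅⁆-≡ : {a x : Fin n} → T (⁅ a ⁆ x) → x ≡ a
⁅⁆-≡ {a = a} {x} = toWitness {a? = x ≟ a}

⁅⁆-self : (a : Fin n) → T (⁅ a ⁆ a)
⁅⁆-self a = fromWitness refl

count-⁅⁆ : (a : Fin n) → count ⁅ a ⁆ ≡ 1
count-⁅⁆ a = trans (∑-δ (map 𝟙 ⁅ a ⁆) a (λ x x≢a → 𝟙-¬T (x≢a ∘ ⁅⁆-≡)))
                   (𝟙-cong (λ _ → _) (λ _ → ⁅⁆-self a))

∑-select : (B : Fin n → Bool) (i : Fin n) → sum (λ a → 𝟙 (⁅ a ⁆ i ∧ B a)) ≡ 𝟙 (B i)
∑-select B i = trans (∑-δ (λ a → 𝟙 (⁅ a ⁆ i ∧ B a)) i (λ a a≢i → 𝟙-¬T (λ t → a≢i (sym (⁅⁆-≡ (T∧⇒Tˡ t))))))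
                     (𝟙-cong T∧⇒Tʳ (λ t → T×T⇒T∧ (⁅⁆-self i) t))

count-< : ∀ {n q} → q ≤ n → count {n} (λ x → toℕ x <ᵇ q) ≡ q
count-< {zero}  z≤n     = refl
count-< {suc n} z≤n     = ∑-zero {suc n} (λ x → 𝟙 (toℕ x <ᵇ 0)) (λ _ → refl)
count-< {suc n} (s≤s p) = cong suc (count-< p)

count-≥ : ∀ n q → count {n} (λ x → q ≤ᵇ toℕ x) ≡ n ∸ q
count-≥ n       zero    = trans (∑-const n 1) (*-identityʳ n)
count-≥ zero    (suc q) = refl
count-≥ (suc n) (suc q) = trans (sum-cong-≗ {n} (λ x → cong 𝟙 (<ᵇ-suc q (toℕ x)))) (count-≥ n q)

count-∧<⇒∃ : (A B : Fin m → Bool) → count (λ x → A x ∧ B x) < count A → ∃ λ a → T (A a) × ¬ T (B a)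
count-∧<⇒∃ {zero}  A B ()
count-∧<⇒∃ {suc m} A B A∧B<A with A zero in A₀ | B zero in B₀
... | true  | false = zero , subst T (sym A₀) _ , subst T B₀
... | true  | true  = Σ-map suc id (count-∧<⇒∃ (A ∘ suc) (B ∘ suc) (s≤s⁻¹ A∧B<A))
... | false | _     = Σ-map suc id (count-∧<⇒∃ (A ∘ suc) (B ∘ suc) A∧B<A)

T⇒1≤count : (A : Fin m → Bool) (a : Fin m) → T (A a) → 1 ≤ count A
T⇒1≤count A a Aa = ≤-trans (≤-reflexive (sym (count-⁅⁆ a)))
                            (count-mono {B = A} (λ x x≡a → subst (T ∘ A) (sym (⁅⁆-≡ x≡a)) Aa))

T×T⇒2≤count : (A : Fin m → Bool) (a b : Fin m) → a ≢ b → T (A a) → T (A b) → 2 ≤ count A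
T×T⇒2≤count A zero    zero    a≢b Aa Ab = ⊥-elim (a≢b refl)
T×T⇒2≤count A zero    (suc b) a≢b Aa Ab = +-mono-≤ (𝟙-mono {true} (λ _ → Aa)) (T⇒1≤count (A ∘ suc) b Ab)
T×T⇒2≤count A (suc a) zero    a≢b Aa Ab = +-mono-≤ (𝟙-mono {true} (λ _ → Ab)) (T⇒1≤count (A ∘ suc) a Aa)
T×T⇒2≤count A (suc a) (suc b) a≢b Aa Ab =
  ≤-trans (T×T⇒2≤count (A ∘ suc) a b (a≢b ∘ cong suc) Aa Ab) (m≤n+m _ (𝟙 (A zero)))

1≤count⇒∃ : (A : Fin m → Bool) → 1 ≤ count A → ∃ λ a → T (A a)
1≤count⇒∃ {suc m} A 1≤A with A zero in A₀
... | true  = zero , subst T (sym A₀) _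
... | false = Σ-map suc id (1≤count⇒∃ (A ∘ suc) 1≤A)

2≤count⇒∃ : (A : Fin m → Bool) → 2 ≤ count A → ∃ λ a → ∃ λ b → a ≢ b × T (A a) × T (A b)
2≤count⇒∃ {suc m} A 2≤A with A zero in A₀
... | true with 1≤count⇒∃ (A ∘ suc) (s≤s⁻¹ 2≤A)
...   | b , Ab = zero , suc b , (λ ()) , subst T (sym A₀) _ , Ab
2≤count⇒∃ {suc m} A 2≤A | false with 2≤count⇒∃ (A ∘ suc) 2≤A
...   | a , b , a≢b , Aa , Ab = suc a , suc b , a≢b ∘ Finₚ.suc-injective , Aa , Ab

-- Families of subsets of Fin n

Label : ℕ → Set
Label n = Fin n → Bool

total : (Label n → ℕ) → Vector (Label n) m → ℕ
total h ℬ = sum (map h ℬ)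

degree : Vector (Label n) m → Fin n → ℕ
degree ℬ i = count (λ x → ℬ x i)

codegree : Vector (Label n) m → Fin n → Fin n → ℕ
codegree ℬ i j = count (λ x → ℬ x i ∧ ℬ x j)

excess : Vector (Label n) m → ℕ
excess = total (λ L → count L ∸ 2)

record BalancedFamily (n k d e : ℕ) : Set where
  field
    size      : ℕ
    members   : Vector (Label n) size
    degree≡   : ∀ i → degree members i ≡ k
    codegree≡ : ∀ i j → i ≢ j → codegree members i j ≡ d
    excess≡   : excess members ≡ e

codegree-sym : (ℬ : Vector (Label n) m) (i j : Fin n) → codegree ℬ i j ≡ codegree ℬ j i
codegree-sym ℬ i j = sum-cong-≗ (λ x → cong 𝟙 (∧-comm (ℬ x i) (ℬ x j)))

codegree-from-< : (ℬ : Vector (Label n) m) {d : ℕ} →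
  (∀ i j → toℕ i < toℕ j → codegree ℬ i j ≡ d) → ∀ i j → i ≢ j → codegree ℬ i j ≡ d
codegree-from-< ℬ codeg< i j i≢j with Finₚ.<-cmp i j
... | tri< i<j _ _ = codeg< i j i<j
... | tri≈ _ i≡j _ = ⊥-elim (i≢j i≡j)
... | tri> _ _ j<i = trans (codegree-sym ℬ i j) (codeg< j i j<i)

sizes≡degrees : (ℬ : Vector (Label n) m) →
  count (λ x → 1 ≤ᵇ count (ℬ x)) + count (λ x → 2 ≤ᵇ count (ℬ x)) + excess ℬ ≡ sum (degree ℬ)
sizes≡degrees {n} ℬ = begin
  count (λ x → 1 ≤ᵇ count (ℬ x)) + count (λ x → 2 ≤ᵇ count (ℬ x)) + excess ℬ
    ≡⟨ cong (_+ excess ℬ) (∑-distrib-+ (λ x → 𝟙 (1 ≤ᵇ count (ℬ x))) (λ x → 𝟙 (2 ≤ᵇ count (ℬ x)))) ⟨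
  sum (λ x → 𝟙 (1 ≤ᵇ count (ℬ x)) + 𝟙 (2 ≤ᵇ count (ℬ x))) + excess ℬ
    ≡⟨ ∑-distrib-+ (λ x → 𝟙 (1 ≤ᵇ count (ℬ x)) + 𝟙 (2 ≤ᵇ count (ℬ x))) (λ x → count (ℬ x) ∸ 2) ⟨
  sum (λ x → 𝟙 (1 ≤ᵇ count (ℬ x)) + 𝟙 (2 ≤ᵇ count (ℬ x)) + (count (ℬ x) ∸ 2))
    ≡⟨ sum-cong-≗ (λ x → split (count (ℬ x))) ⟩
  sum (λ x → sum (λ i → 𝟙 (ℬ x i)))
    ≡⟨ ∑-comm (λ x i → 𝟙 (ℬ x i)) ⟩
  sum (degree ℬ) ∎
  where
  open ≡-Reasoning
  split : ∀ c → 𝟙 (1 ≤ᵇ c) + 𝟙 (2 ≤ᵇ c) + (c ∸ 2) ≡ c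
  split zero          = refl
  split (suc zero)    = refl
  split (suc (suc c)) = refl

sizes-balanced : ∀ {n k d e} (ℬ : BalancedFamily n k d e) → let open BalancedFamily ℬ in
  count (λ x → 1 ≤ᵇ count (members x)) + count (λ x → 2 ≤ᵇ count (members x)) + e ≡ n * k
sizes-balanced {n} {k} {e = e} ℬ = begin
  count (λ x → 1 ≤ᵇ count (members x)) + count (λ x → 2 ≤ᵇ count (members x)) + e
    ≡⟨ cong (count (λ x → 1 ≤ᵇ count (members x)) + count (λ x → 2 ≤ᵇ count (members x)) +_) excess≡ ⟨
  count (λ x → 1 ≤ᵇ count (members x)) + count (λ x → 2 ≤ᵇ count (members x)) + excess members
    ≡⟨ sizes≡degrees members ⟩
  sum (degree members)  ≡⟨ sum-cong-≗ degree≡ ⟩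
  sum {n} (λ _ → k)     ≡⟨ ∑-const n k ⟩
  n * k                 ∎
  where
  open BalancedFamily ℬ
  open ≡-Reasoning

-- The construction

present : ℕ → Fin n → Fin n → Bool
present s a b = (toℕ a <ᵇ toℕ b) ∧ (s ≤ᵇ toℕ b)

-- Absent pairs, like the unused copies in singletons below, are empty members: coordinates
-- lying in no π_i, which change none of the counts.
edge : ℕ → Fin n → Fin n → Label n
edge s a b x = (⁅ a ⁆ x ∨ ⁅ b ⁆ x) ∧ present s a b

block : ℕ → Label n
block s x = toℕ x <ᵇ s

level : ℕ → Vector (Label n) (n * n + 1)
level s = concat (edge s) ++ (block s ∷ [])

total-level : (h : Label n → ℕ) (s : ℕ) →
              total h (level {n} s) ≡ sum (λ a → sum (λ b → h (edge s a b))) + h (block s)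
total-level h s = begin
  total h (level s)                                          ≡⟨ ∑-++ h (concat (edge s)) (block s ∷ []) ⟩
  total h (concat (edge s)) + (h (block s) + 0)              ≡⟨ cong₂ _+_ (∑-concat h (edge s)) (+-identityʳ _) ⟩
  sum (λ a → sum (λ b → h (edge s a b))) + h (block s)       ∎
  where open ≡-Reasoning

degree-edges : (s : ℕ) (i : Fin n) →
  sum (λ a → sum (λ b → 𝟙 (edge s a b i))) ≤ count (present s i) + count (λ a → present s a i)
degree-edges s i = begin
  sum (λ a → sum (λ b → 𝟙 (edge s a b i)))
    ≤⟨ ∑-mono-≤ (λ a → ∑-mono-≤ (λ b → 𝟙-∨-∧ (⁅ a ⁆ i) (⁅ b ⁆ i) (present s a b))) ⟩
  sum (λ a → sum (λ b → 𝟙 (⁅ a ⁆ i ∧ present s a b) + 𝟙 (⁅ b ⁆ i ∧ present s a b)))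
    ≡⟨ sum-cong-≗ (λ a → ∑-distrib-+ (λ b → 𝟙 (⁅ a ⁆ i ∧ present s a b)) (λ b → 𝟙 (⁅ b ⁆ i ∧ present s a b))) ⟩
  sum (λ a → sum (λ b → 𝟙 (⁅ a ⁆ i ∧ present s a b)) + sum (λ b → 𝟙 (⁅ b ⁆ i ∧ present s a b)))
    ≡⟨ ∑-distrib-+ (λ a → sum (λ b → 𝟙 (⁅ a ⁆ i ∧ present s a b))) (λ a → sum (λ b → 𝟙 (⁅ b ⁆ i ∧ present s a b))) ⟩
  sum (λ a → sum (λ b → 𝟙 (⁅ a ⁆ i ∧ present s a b))) + sum (λ a → sum (λ b → 𝟙 (⁅ b ⁆ i ∧ present s a b)))
    ≡⟨ cong₂ _+_ (trans (∑-comm (λ a b → 𝟙 (⁅ a ⁆ i ∧ present s a b))) (sum-cong-≗ (λ b → ∑-select (λ a → present s a b) i)))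
                 (sum-cong-≗ (λ a → ∑-select (present s a) i)) ⟩
  count (present s i) + count (λ a → present s a i) ∎
  where open ≤-Reasoning

level-degree-inside : ∀ s {i : Fin n} → toℕ i < s → degree (level {n} s) i ≤ n ∸ s + 1
level-degree-inside {n} s {i} i<s = begin
  degree (level s) i
    ≡⟨ total-level (λ L → 𝟙 (L i)) s ⟩
  sum (λ a → sum (λ b → 𝟙 (edge s a b i))) + 𝟙 (block s i)
    ≤⟨ +-mono-≤ (degree-edges s i) (𝟙≤1 _) ⟩
  count (present s i) + count (λ a → present s a i) + 1
    ≡⟨ cong (λ c → count (present s i) + c + 1) (∑-zero (λ a → 𝟙 (present s a i)) (λ a → 𝟙-¬T (s≰i ∘ T∧⇒Tʳ))) ⟩
  count (present s i) + 0 + 1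
    ≤⟨ +-monoˡ-≤ 1 (+-monoˡ-≤ 0 (count-mono {A = present s i} {B = λ b → s ≤ᵇ toℕ b} (λ b → T∧⇒Tʳ))) ⟩
  count {n} (λ b → s ≤ᵇ toℕ b) + 0 + 1
    ≡⟨ cong (_+ 1) (trans (+-identityʳ _) (count-≥ n s)) ⟩
  n ∸ s + 1 ∎
  where
  open ≤-Reasoning
  s≰i : ¬ T (s ≤ᵇ toℕ i)
  s≰i t = <⇒≱ i<s (≤ᵇ⇒≤ s (toℕ i) t)

level-degree-outside : ∀ s {i : Fin n} → s ≤ toℕ i → degree (level {n} s) i ≤ n ∸ suc (toℕ i) + toℕ i
level-degree-outside {n} s {i} s≤i = begin
  degree (level s) i
    ≡⟨ total-level (λ L → 𝟙 (L i)) s ⟩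
  sum (λ a → sum (λ b → 𝟙 (edge s a b i))) + 𝟙 (block s i)
    ≡⟨ cong (sum (λ a → sum (λ b → 𝟙 (edge s a b i))) +_) (𝟙-¬T (λ i<s → <⇒≱ (<ᵇ⇒< (toℕ i) s i<s) s≤i)) ⟩
  sum (λ a → sum (λ b → 𝟙 (edge s a b i))) + 0
    ≤⟨ +-monoˡ-≤ 0 (degree-edges s i) ⟩
  count (present s i) + count (λ a → present s a i) + 0
    ≡⟨ cong (λ c → count (present s i) + c + 0)
         (count-cong {A = λ a → present s a i} {B = λ a → toℕ a <ᵇ toℕ i} (λ a → T∧⇒Tˡ) (λ a a<i → T×T⇒T∧ a<i (≤⇒≤ᵇ s≤i))) ⟩
  count (present s i) + count {n} (λ a → toℕ a <ᵇ toℕ i) + 0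
    ≤⟨ +-monoˡ-≤ 0 (+-monoˡ-≤ _ (count-mono {A = present s i} {B = λ b → suc (toℕ i) ≤ᵇ toℕ b} (λ b → T∧⇒Tˡ))) ⟩
  count {n} (λ b → suc (toℕ i) ≤ᵇ toℕ b) + count {n} (λ a → toℕ a <ᵇ toℕ i) + 0
    ≡⟨ trans (+-identityʳ _) (cong₂ _+_ (count-≥ n (suc (toℕ i))) (count-< (<⇒≤ (Finₚ.toℕ<n i)))) ⟩
  n ∸ suc (toℕ i) + toℕ i ∎
  where open ≤-Reasoning

level-degree : ∀ {s} → 2 ≤ s → s ≤ n → (i : Fin n) → degree (level {n} s) i ≤ n ∸ 1
level-degree {n} {s} 2≤s s≤n i with toℕ i <? s
... | yes i<s = ≤-trans (level-degree-inside s i<s) (shrink 2≤s s≤n)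
  where
  shrink : ∀ {s n} → 2 ≤ s → s ≤ n → n ∸ s + 1 ≤ n ∸ 1
  shrink {suc s} {suc n} (s≤s 1≤s) (s≤s s≤n) = ≤-trans (+-monoʳ-≤ (n ∸ s) 1≤s) (≤-reflexive (m∸n+n≡m s≤n))
... | no i≮s = ≤-trans (level-degree-outside s (≮⇒≥ i≮s)) (≤-reflexive (regroup (Finₚ.toℕ<n i)))
  where
  regroup : ∀ {i n} → suc i ≤ n → n ∸ suc i + i ≡ n ∸ 1
  regroup {n = suc n} (s≤s i≤n) = m∸n+n≡m i≤n

edge-endpoints : ∀ s {a b x : Fin n} → T (edge s a b x) → x ≡ a ⊎ x ≡ b
edge-endpoints s {a} {b} {x} t = ⊎-map ⁅⁆-≡ ⁅⁆-≡ (to T-∨ (T∧⇒Tˡ {⁅ a ⁆ x ∨ ⁅ b ⁆ x} t))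

edge-ordered : ∀ s {a b x : Fin n} → T (edge s a b x) → toℕ a < toℕ b
edge-ordered s {a} {b} {x} t = <ᵇ⇒< _ _ (T∧⇒Tˡ (T∧⇒Tʳ {⁅ a ⁆ x ∨ ⁅ b ⁆ x} t))

edge-∋ˡ : ∀ s {a b : Fin n} → T (present s a b) → T (edge s a b a)
edge-∋ˡ s {a} {b} p = T×T⇒T∧ {⁅ a ⁆ a ∨ ⁅ b ⁆ a} (from T-∨ (inj₁ (⁅⁆-self a))) p

edge-∋ʳ : ∀ s {a b : Fin n} → T (present s a b) → T (edge s a b b)
edge-∋ʳ s {a} {b} p = T×T⇒T∧ {⁅ a ⁆ b ∨ ⁅ b ⁆ b} (from T-∨ (inj₂ (⁅⁆-self b))) p

edge-both : ∀ s {i j a b : Fin n} → toℕ i < toℕ j → T (edge s a b i ∧ edge s a b j) → a ≡ i × b ≡ j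
edge-both s {i} {j} {a} {b} i<j t
  with edge-endpoints s {a} {b} {i} (T∧⇒Tˡ {edge s a b i} t) | edge-endpoints s {a} {b} {j} (T∧⇒Tʳ {edge s a b i} t)
... | inj₁ refl | inj₁ refl = ⊥-elim (<-irrefl refl i<j)
... | inj₁ refl | inj₂ refl = refl , refl
... | inj₂ refl | inj₁ refl = ⊥-elim (<-asym i<j (edge-ordered s {j} {i} {i} (T∧⇒Tˡ {edge s j i i} t)))
... | inj₂ refl | inj₂ refl = ⊥-elim (<-irrefl refl i<j)

𝟙-edge-both : ∀ s {i j : Fin n} → toℕ i < toℕ j → 𝟙 (edge s i j i ∧ edge s i j j) ≡ 𝟙 (s ≤ᵇ toℕ j)
𝟙-edge-both s {i} {j} i<j = 𝟙-cong (λ t → T∧⇒Tʳ (T∧⇒Tʳ {⁅ i ⁆ i ∨ ⁅ j ⁆ i} (T∧⇒Tˡ {edge s i j i} t)))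
  λ s≤j → let ij = T×T⇒T∧ (<⇒<ᵇ i<j) s≤j in T×T⇒T∧ (edge-∋ˡ s ij) (edge-∋ʳ s ij)

level-codegree : ∀ s (i j : Fin n) → i ≢ j → codegree (level s) i j ≡ 1
level-codegree {n} s = codegree-from-< (level s) codegree<
  where
  codegree< : ∀ i j → toℕ i < toℕ j → codegree (level s) i j ≡ 1
  codegree< i j i<j = begin
    codegree (level s) i j
      ≡⟨ total-level (λ L → 𝟙 (L i ∧ L j)) s ⟩
    sum (λ a → sum (λ b → 𝟙 (edge s a b i ∧ edge s a b j))) + 𝟙 (block s i ∧ block s j)
      ≡⟨ cong₂ _+_ (∑-δ (λ a → sum (λ b → 𝟙 (edge s a b i ∧ edge s a b j))) i
                       (λ a a≢i → ∑-zero (λ b → 𝟙 (edge s a b i ∧ edge s a b j)) (λ b → 𝟙-¬T (λ t → a≢i (proj₁ (edge-both s i<j t))))))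
                   block-both ⟩
    sum (λ b → 𝟙 (edge s i b i ∧ edge s i b j)) + 𝟙 (toℕ j <ᵇ s)
      ≡⟨ cong (_+ 𝟙 (toℕ j <ᵇ s)) (∑-δ (λ b → 𝟙 (edge s i b i ∧ edge s i b j)) j
                                        (λ b b≢j → 𝟙-¬T (λ t → b≢j (proj₂ (edge-both s i<j t))))) ⟩
    𝟙 (edge s i j i ∧ edge s i j j) + 𝟙 (toℕ j <ᵇ s)
      ≡⟨ cong (_+ 𝟙 (toℕ j <ᵇ s)) (𝟙-edge-both s i<j) ⟩
    𝟙 (s ≤ᵇ toℕ j) + 𝟙 (toℕ j <ᵇ s)
      ≡⟨ 𝟙-≤ᵇ+𝟙-<ᵇ s (toℕ j) ⟩
    1 ∎
    where
    open ≡-Reasoning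
    block-both : 𝟙 (block s i ∧ block s j) ≡ 𝟙 (toℕ j <ᵇ s)
    block-both = 𝟙-cong (T∧⇒Tʳ {block s i}) (λ j<s → T×T⇒T∧ (<⇒<ᵇ (<-trans i<j (<ᵇ⇒< (toℕ j) s j<s))) j<s)

count-edge : ∀ s (a b : Fin n) → count (edge s a b) ≤ 2
count-edge s a b = begin
  count (edge s a b)                       ≤⟨ count-mono {B = λ x → ⁅ a ⁆ x ∨ ⁅ b ⁆ x} (λ x → T∧⇒Tˡ) ⟩
  count (λ x → ⁅ a ⁆ x ∨ ⁅ b ⁆ x)          ≤⟨ count-∨ ⁅ a ⁆ ⁅ b ⁆ ⟩
  count ⁅ a ⁆ + count ⁅ b ⁆                ≡⟨ cong₂ _+_ (count-⁅⁆ a) (count-⁅⁆ b) ⟩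
  2                                        ∎
  where open ≤-Reasoning

level-excess : ∀ {s} → s ≤ n → excess (level {n} s) ≡ s ∸ 2
level-excess {n} {s} s≤n = begin
  excess (level {n} s)
    ≡⟨ total-level {n} (λ L → count L ∸ 2) s ⟩
  sum {n} (λ a → sum (λ b → count (edge s a b) ∸ 2)) + (count (block {n} s) ∸ 2)
    ≡⟨ cong₂ _+_ (∑-zero {n} _ (λ a → ∑-zero _ (λ b → m≤n⇒m∸n≡0 (count-edge s a b))))
                 (cong (_∸ 2) (count-< s≤n)) ⟩
  s ∸ 2 ∎
  where open ≡-Reasoning

levelSize : (η ε : ℕ) {d : ℕ} → Fin d → ℕ
levelSize η ε r = η + 𝟙 (toℕ r <ᵇ ε)

levels : (η ε d : ℕ) → Fin d → Vector (Label n) (n * n + 1)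
levels η ε d r = level (levelSize η ε r)

core : (η ε d : ℕ) → Vector (Label n) (d * (n * n + 1))
core η ε d = concat (levels η ε d)

module _ {η ε d : ℕ} (2≤η : 2 ≤ η) (η<n : η < n) where

  private
    2≤levelSize : (r : Fin d) → 2 ≤ levelSize η ε r
    2≤levelSize r = ≤-trans 2≤η (m≤m+n η _)

    levelSize≤n : (r : Fin d) → levelSize η ε r ≤ n
    levelSize≤n r = ≤-trans (+-monoʳ-≤ η (𝟙≤1 _)) (≤-trans (≤-reflexive (+-comm η 1)) η<n)

  core-degree : (i : Fin n) → degree (core η ε d) i ≤ d * (n ∸ 1)
  core-degree i = begin
    degree (core η ε d) i                            ≡⟨ ∑-concat (λ L → 𝟙 (L i)) (levels η ε d) ⟩
    sum {d} (λ r → degree (level (levelSize η ε r)) i) ≤⟨ ∑-mono-≤ {d} (λ r → level-degree (2≤levelSize r) (levelSize≤n r) i) ⟩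
    sum {d} (λ _ → n ∸ 1)                            ≡⟨ ∑-const d (n ∸ 1) ⟩
    d * (n ∸ 1)                                      ∎
    where open ≤-Reasoning

  core-codegree : (i j : Fin n) → i ≢ j → codegree (core η ε d) i j ≡ d
  core-codegree i j i≢j = begin
    codegree (core η ε d) i j                            ≡⟨ ∑-concat (λ L → 𝟙 (L i ∧ L j)) (levels η ε d) ⟩
    sum {d} (λ r → codegree (level (levelSize η ε r)) i j) ≡⟨ sum-cong-≗ {d} (λ r → level-codegree (levelSize η ε r) i j i≢j) ⟩
    sum {d} (λ _ → 1)                                    ≡⟨ trans (∑-const d 1) (*-identityʳ d) ⟩
    d                                                    ∎
    where open ≡-Reasoning

  core-excess : ε ≤ d → excess (core {n} η ε d) ≡ (η ∸ 2) * d + ε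
  core-excess ε≤d = begin
    excess (core {n} η ε d)
      ≡⟨ ∑-concat (λ L → count L ∸ 2) (levels {n} η ε d) ⟩
    sum {d} (λ r → excess (level {n} (levelSize η ε r)))
      ≡⟨ sum-cong-≗ {d} (λ r → level-excess (levelSize≤n r)) ⟩
    sum {d} (λ r → η + 𝟙 (toℕ r <ᵇ ε) ∸ 2)
      ≡⟨ sum-cong-≗ {d} (λ r → +-∸-comm {η} (𝟙 (toℕ r <ᵇ ε)) 2≤η) ⟩
    sum {d} (λ r → η ∸ 2 + 𝟙 (toℕ r <ᵇ ε))
      ≡⟨ ∑-distrib-+ {d} (λ _ → η ∸ 2) (λ r → 𝟙 (toℕ r <ᵇ ε)) ⟩
    sum {d} (λ _ → η ∸ 2) + count {d} (λ r → toℕ r <ᵇ ε)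
      ≡⟨ cong₂ _+_ (trans (∑-const d (η ∸ 2)) (*-comm d (η ∸ 2))) (count-< ε≤d) ⟩
    (η ∸ 2) * d + ε ∎
    where open ≡-Reasoning

singletonCopy : ∀ {k} → (Fin n → ℕ) → Fin n → Fin k → Label n
singletonCopy q a c x = ⁅ a ⁆ x ∧ (toℕ c <ᵇ q a)

singletons : (k : ℕ) → (Fin n → ℕ) → Vector (Label n) (n * k)
singletons k q = concat (singletonCopy q)

module _ {k : ℕ} {q : Fin n → ℕ} where

  singletons-degree : (∀ a → q a ≤ k) → (i : Fin n) → degree (singletons k q) i ≡ q i
  singletons-degree q≤k i = begin
    degree (singletons k q) i                              ≡⟨ ∑-concat (λ L → 𝟙 (L i)) (singletonCopy q) ⟩
    sum (λ a → sum {k} (λ c → 𝟙 (singletonCopy q a c i)))  ≡⟨ ∑-comm (λ a (c : Fin k) → 𝟙 (singletonCopy q a c i)) ⟩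
    sum {k} (λ c → sum (λ a → 𝟙 (singletonCopy q a c i)))  ≡⟨ sum-cong-≗ {k} (λ c → ∑-select (λ a → toℕ c <ᵇ q a) i) ⟩
    count {k} (λ c → toℕ c <ᵇ q i)                         ≡⟨ count-< (q≤k i) ⟩
    q i                                                    ∎
    where open ≡-Reasoning

  singletons-codegree : (i j : Fin n) → i ≢ j → codegree (singletons k q) i j ≡ 0
  singletons-codegree i j i≢j = trans (∑-concat (λ L → 𝟙 (L i ∧ L j)) (singletonCopy q))
    (∑-zero {n} _ (λ a → ∑-zero {k} _ (λ c → 𝟙-¬T (λ t → i≢j (both a c t)))))
    where
    a∋ : ∀ x {a} {c} → T (singletonCopy q a c x) → x ≡ a
    a∋ x {a} t = ⁅⁆-≡ (T∧⇒Tˡ {⁅ a ⁆ x} t)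
    both : ∀ a c → T (singletonCopy q a c i ∧ singletonCopy q a c j) → i ≡ j
    both a c t = trans (a∋ i (T∧⇒Tˡ {singletonCopy q a c i} t)) (sym (a∋ j (T∧⇒Tʳ {singletonCopy q a c i} t)))

  singletons-excess : excess (singletons k q) ≡ 0
  singletons-excess = trans (∑-concat (λ L → count L ∸ 2) (singletonCopy q))
    (∑-zero {n} _ (λ a → ∑-zero {k} _ (λ c → m≤n⇒m∸n≡0 (≤-trans (size≤1 a c) (s≤s z≤n)))))
    where
    size≤1 : ∀ a c → count (singletonCopy q a c) ≤ 1
    size≤1 a c = ≤-trans (count-mono {B = ⁅ a ⁆} (λ x → T∧⇒Tˡ)) (≤-reflexive (count-⁅⁆ a))

padToDegree : ∀ {k d e} (ℬ : Vector (Label n) m) → (∀ i → degree ℬ i ≤ k) →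
  (∀ i j → i ≢ j → codegree ℬ i j ≡ d) → excess ℬ ≡ e → BalancedFamily n k d e
padToDegree {n} {m} {k} {d} {e} ℬ deg≤k codeg≡d excess≡e = record
  { members   = ℬ ++ singletons k deficit
  ; degree≡   = λ i → begin
      degree (ℬ ++ singletons k deficit) i            ≡⟨ ∑-++ (λ L → 𝟙 (L i)) ℬ (singletons k deficit) ⟩
      degree ℬ i + degree (singletons k deficit) i    ≡⟨ cong (degree ℬ i +_) (singletons-degree {q = deficit} (λ a → m∸n≤m k (degree ℬ a)) i) ⟩
      degree ℬ i + (k ∸ degree ℬ i)                   ≡⟨ m+[n∸m]≡n (deg≤k i) ⟩
      k                                               ∎
  ; codegree≡ = λ i j i≢j → begin
      codegree (ℬ ++ singletons k deficit) i j                ≡⟨ ∑-++ (λ L → 𝟙 (L i ∧ L j)) ℬ (singletons k deficit) ⟩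
      codegree ℬ i j + codegree (singletons k deficit) i j    ≡⟨ cong₂ _+_ (codeg≡d i j i≢j) (singletons-codegree {q = deficit} i j i≢j) ⟩
      d + 0                                                   ≡⟨ +-identityʳ d ⟩
      d                                                       ∎
  ; excess≡   = begin
      excess (ℬ ++ singletons k deficit)               ≡⟨ ∑-++ (λ L → count L ∸ 2) ℬ (singletons k deficit) ⟩
      excess ℬ + excess (singletons k deficit)         ≡⟨ cong₂ _+_ excess≡e (singletons-excess {q = deficit}) ⟩
      e + 0                                            ≡⟨ +-identityʳ e ⟩
      e                                                ∎
  }
  where
  open ≡-Reasoning
  deficit : Fin n → ℕ
  deficit i = k ∸ degree ℬ i

balancedFamily : ∀ {n k d η ε} → 2 ≤ η → η < n → ε ≤ d → (n ∸ 1) * d ≤ k →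
                 BalancedFamily n k d ((η ∸ 2) * d + ε)
balancedFamily {n} {k} {d} {η} {ε} 2≤η η<n ε≤d nd≤k =
  padToDegree (core η ε d)
    (λ i → ≤-trans (core-degree {ε = ε} {d} 2≤η η<n i) (≤-trans (≤-reflexive (*-comm d (n ∸ 1))) nd≤k))
    (core-codegree {ε = ε} 2≤η η<n) (core-excess 2≤η η<n ε≤d)

-- Coordinate subspaces

module CoordinateSubspaces {c ℓ : Level} (F : FiniteField c ℓ) where

  open FiniteField F
    using (Carrier; _≈_; 0#; 1#; 0≉1; setoid; reflexive)
    renaming ( _+_ to _⊕_; _*_ to _⊛_; refl to ≈-refl; sym to ≈-sym; trans to ≈-trans
             ; +-cong to ⊕-cong; *-cong to ⊛-cong; +-identityˡ to ⊕-identityˡ; +-identityʳ to ⊕-identityʳ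
             ; *-identityˡ to ⊛-identityˡ; *-identityʳ to ⊛-identityʳ; zeroʳ to ⊛-zeroʳ)
  open LinearAlgebra F hiding (Vector)
  open import Relation.Binary.Reasoning.Setoid setoid

  e : Fin m → Vector Carrier m
  e zero    zero    = 1#
  e zero    (suc b) = 0#
  e (suc a) zero    = 0#
  e (suc a) (suc b) = e a b

  e-diag : (a : Fin m) → e a a ≡ 1#
  e-diag zero    = refl
  e-diag (suc a) = e-diag a

  e-off : (a b : Fin m) → a ≢ b → e a b ≡ 0#
  e-off zero    zero    a≢b = ⊥-elim (a≢b refl)
  e-off zero    (suc b) a≢b = refl
  e-off (suc a) zero    a≢b = refl
  e-off (suc a) (suc b) a≢b = e-off a b (a≢b ∘ cong suc)

  Coord : (Fin m → Bool) → VSet m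
  Coord A x = Lift c (∀ a → ¬ T (A a) → x a ≈ 0#)

  Coord-resp : (A : Fin m → Bool) {u v : Vector Carrier m} → u ≈ᵥ v → Coord A u → Coord A v
  Coord-resp A u≈v (lift u₀) = lift (λ a ¬Aa → ≈-trans (≈-sym (u≈v a)) (u₀ a ¬Aa))

  Coord-isSubspace : (A : Fin m → Bool) → IsSubspace (Coord A)
  Coord-isSubspace A = record
    { resp     = Coord-resp A
    ; has-0    = lift (λ _ _ → ≈-refl)
    ; +-closed = λ (lift u₀) (lift v₀) → lift (λ a ¬Aa → ≈-trans (⊕-cong (u₀ a ¬Aa) (v₀ a ¬Aa)) (⊕-identityʳ 0#))
    ; ·-closed = λ x (lift v₀) → lift (λ a ¬Aa → ≈-trans (⊛-cong ≈-refl (v₀ a ¬Aa)) (⊛-zeroʳ x))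
    }

  lincomb-vanishes : ∀ {r} (coef : Fin r → Carrier) (vec : Fin r → Vector Carrier m) a →
                     (∀ i → vec i a ≈ 0#) → lincomb coef vec a ≈ 0#
  lincomb-vanishes {r = zero}  coef vec a vanish = ≈-refl
  lincomb-vanishes {r = suc r} coef vec a vanish = begin
    coef zero ⊛ vec zero a ⊕ lincomb (coef ∘ suc) (vec ∘ suc) a ≈⟨ ⊕-cong (⊛-cong ≈-refl (vanish zero))
                                                                    (lincomb-vanishes (coef ∘ suc) (vec ∘ suc) a (vanish ∘ suc)) ⟩
    coef zero ⊛ 0# ⊕ 0#                                       ≈⟨ ⊕-identityʳ _ ⟩
    coef zero ⊛ 0#                                            ≈⟨ ⊛-zeroʳ _ ⟩
    0#                                                        ∎

  lincomb-suc : ∀ {r} (coef : Fin r → Carrier) (vec : Fin r → Vector Carrier (suc m)) a →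
                lincomb coef vec (suc a) ≡ lincomb coef (λ i → vec i ∘ suc) a
  lincomb-suc {r = zero}  coef vec a = refl
  lincomb-suc {r = suc r} coef vec a = cong (coef zero ⊛ vec zero (suc a) ⊕_) (lincomb-suc (coef ∘ suc) (vec ∘ suc) a)

  Coord-lincomb : ∀ {r} (A : Fin m → Bool) (coef : Fin r → Carrier) (vec : Fin r → Vector Carrier m) →
                  (∀ i → Coord A (vec i)) → Coord A (lincomb coef vec)
  Coord-lincomb A coef vec vec∈A =
    lift (λ a ¬Aa → lincomb-vanishes coef vec a (λ i → Lift.lower (vec∈A i) a ¬Aa))

  e∈Coord : (A : Fin m → Bool) {a : Fin m} → T (A a) → Coord A (e a)
  e∈Coord A {a} Aa = lift (λ b ¬Ab → reflexive (e-off a b (λ { refl → ¬Ab Aa })))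

  e∉Coord : (A : Fin m → Bool) {a : Fin m} → ¬ T (A a) → ¬ Coord A (e a)
  e∉Coord A {a} ¬Aa (lift e₀) = 0≉1 (≈-trans (≈-sym (e₀ a ¬Aa)) (reflexive (e-diag a)))

  record CoordBasis (A : Fin m → Bool) : Set (c ⊔ ℓ) where
    field
      dim         : ℕ
      dim≡count   : dim ≡ count A
      pos         : Fin dim → Fin m
      pos∈A       : ∀ r → T (A (pos r))
      independent : LinearlyIndependent (λ r → e (pos r))
      spanning    : ∀ x → Coord A x → ∃ λ coef → lincomb coef (λ r → e (pos r)) ≈ᵥ x

  module _ {A : Fin (suc m) → Bool} (B : CoordBasis (A ∘ suc)) where

    open CoordBasis B

    private
      tail-vanishes : ∀ {r} (coef : Fin r → Carrier) (p : Fin r → Fin m) →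
                      lincomb coef (λ r → e (suc (p r))) zero ≈ 0#
      tail-vanishes coef p = lincomb-vanishes coef _ zero (λ _ → ≈-refl)

      restrict : ∀ {x} → Coord A x → Coord (A ∘ suc) (x ∘ suc)
      restrict (lift x₀) = lift (λ a → x₀ (suc a))

    coordBasis-∈ : T (A zero) → CoordBasis A
    coordBasis-∈ A₀ = record
      { dim         = suc dim
      ; dim≡count   = cong₂ _+_ (𝟙-cong (λ _ → A₀) (λ _ → _)) dim≡count
      ; pos         = pos′
      ; pos∈A       = λ { zero → A₀ ; (suc r) → pos∈A r }
      ; independent = independent′
      ; spanning    = spanning′
      }
      where
      pos′ : Fin (suc dim) → Fin (suc m)
      pos′ zero    = zero
      pos′ (suc r) = suc (pos r)
      independent′ : LinearlyIndependent (λ r → e (pos′ r))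
      independent′ coef comb≈0 zero    = begin
        coef zero                                                 ≈⟨ ≈-sym (⊛-identityʳ _) ⟩
        coef zero ⊛ 1#                                            ≈⟨ ≈-sym (⊕-identityʳ _) ⟩
        coef zero ⊛ 1# ⊕ 0#                                       ≈⟨ ⊕-cong ≈-refl (≈-sym (tail-vanishes (coef ∘ suc) pos)) ⟩
        lincomb coef (λ r → e (pos′ r)) zero                      ≈⟨ comb≈0 zero ⟩
        0#                                                        ∎
      independent′ coef comb≈0 (suc r) = independent (coef ∘ suc) (λ a → begin
        lincomb (coef ∘ suc) (λ r → e (pos r)) a                  ≡⟨ lincomb-suc (coef ∘ suc) (λ r → e (suc (pos r))) a ⟨
        lincomb (coef ∘ suc) (λ r → e (suc (pos r))) (suc a)      ≈⟨ ≈-sym (⊕-identityˡ _) ⟩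
        0# ⊕ lincomb (coef ∘ suc) (λ r → e (suc (pos r))) (suc a) ≈⟨ ⊕-cong (≈-sym (⊛-zeroʳ (coef zero))) ≈-refl ⟩
        lincomb coef (λ r → e (pos′ r)) (suc a)                   ≈⟨ comb≈0 (suc a) ⟩
        0#                                                        ∎) r
      spanning′ : ∀ x → Coord A x → ∃ λ coef → lincomb coef (λ r → e (pos′ r)) ≈ᵥ x
      spanning′ x x∈A with spanning (x ∘ suc) (restrict x∈A)
      ... | coef , comb≈x = (x zero ∷ coef) , λ
        { zero    → ≈-trans (⊕-cong ≈-refl (tail-vanishes coef pos)) (≈-trans (⊕-identityʳ _) (⊛-identityʳ _))
        ; (suc a) → ≈-trans (⊕-cong (⊛-zeroʳ (x zero)) (reflexive (lincomb-suc coef _ a)))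
                            (≈-trans (⊕-identityˡ _) (comb≈x a)) }

    coordBasis-∉ : ¬ T (A zero) → CoordBasis A
    coordBasis-∉ ¬A₀ = record
      { dim         = dim
      ; dim≡count   = cong₂ _+_ (sym (𝟙-¬T ¬A₀)) dim≡count
      ; pos         = suc ∘ pos
      ; pos∈A       = pos∈A
      ; independent = λ coef comb≈0 →
          independent coef (λ a → ≈-trans (reflexive (sym (lincomb-suc coef _ a))) (comb≈0 (suc a)))
      ; spanning    = spanning′
      }
      where
      spanning′ : ∀ x → Coord A x → ∃ λ coef → lincomb coef (λ r → e (suc (pos r))) ≈ᵥ x
      spanning′ x (lift x₀) with spanning (x ∘ suc) (restrict (lift x₀))
      ... | coef , comb≈x = coef , λ
        { zero    → ≈-trans (tail-vanishes coef pos) (≈-sym (x₀ zero ¬A₀))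
        ; (suc a) → ≈-trans (reflexive (lincomb-suc coef _ a)) (comb≈x a) }

  coordBasis : (A : Fin m → Bool) → CoordBasis A
  coordBasis {zero}  A = record
    { dim = 0 ; dim≡count = refl ; pos = λ () ; pos∈A = λ ()
    ; independent = λ _ _ () ; spanning = λ _ _ → (λ ()) , (λ ()) }
  coordBasis {suc m} A with T? (A zero)
  ... | yes A₀ = coordBasis-∈ (coordBasis (A ∘ suc)) A₀
  ... | no ¬A₀ = coordBasis-∉ (coordBasis (A ∘ suc)) ¬A₀

  HasDim-cong : ∀ {V W : VSet m} {d} → SameSet V W → HasDim V d → HasDim W d
  HasDim-cong V≡W (b , indep , b∈V , spans) =
    b , indep , (λ r → proj₁ (V≡W _) (b∈V r)) , (λ x x∈W → spans x (proj₂ (V≡W x) x∈W))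

  Coord-hasDim : (A : Fin m → Bool) → HasDim (Coord A) (count A)
  Coord-hasDim A = subst (HasDim (Coord A)) dim≡count
    ((λ r → e (pos r)) , independent , (λ r → e∈Coord A (pos∈A r)) , spanning)
    where open CoordBasis (coordBasis A)

  ∈Span : ∀ {G : VSet m} {v} → G v → Span G v
  ∈Span {v = v} v∈G = 1 , (λ _ → v) , (λ _ → v∈G) , (λ _ → 1#) ,
                      (λ a → ≈-trans (⊕-identityʳ _) (⊛-identityˡ (v a)))

  Span-hasDim : ∀ {G : VSet m} (Q : Fin m → Bool) → (∀ {x} → G x → Coord Q x) →
                (∀ a → T (Q a) → G (e a)) → HasDim (Span G) (count Q)
  Span-hasDim {G = G} Q G⊆Q e∈G = subst (HasDim (Span G)) dim≡count
    ( (λ r → e (pos r)) , independent , (λ r → ∈Span {G = G} (e∈G (pos r) (pos∈A r)))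
    , λ x (_ , vec , vec∈G , coef , comb≈x) →
        spanning x (Coord-resp Q comb≈x (Coord-lincomb Q coef vec (λ i → G⊆Q (vec∈G i)))) )
    where open CoordBasis (coordBasis Q)

  Coord-∩ : (A B : Fin m → Bool) → SameSet (Coord (λ a → A a ∧ B a)) (Coord A ∩ Coord B)
  Coord-∩ A B x = to∩ , from∩
    where
    to∩ : Coord (λ a → A a ∧ B a) x → (Coord A ∩ Coord B) x
    to∩ (lift x₀) = lift (λ a ¬Aa → x₀ a (¬Aa ∘ T∧⇒Tˡ)) , lift (λ a ¬Ba → x₀ a (¬Ba ∘ T∧⇒Tʳ {A a}))
    from∩ : (Coord A ∩ Coord B) x → Coord (λ a → A a ∧ B a) x
    from∩ (lift xA , lift xB) = lift λ a ¬AB → case T? (A a) of λ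
      { (yes Aa) → xB a (λ Ba → ¬AB (T×T⇒T∧ Aa Ba))
      ; (no ¬Aa) → xA a ¬Aa }

  Coord-distinct : (A B : Fin m → Bool) (a : Fin m) → T (A a) → ¬ T (B a) → ¬ SameSet (Coord A) (Coord B)
  Coord-distinct A B a Aa ¬Ba A≡B = e∉Coord B ¬Ba (proj₁ (A≡B (e a)) (e∈Coord A Aa))

  module _ (ℬ : Vector (Label n) m) where

    subspaces : Fin n → VSet m
    subspaces i = Coord (λ x → ℬ x i)

    SpanAll-hasDim : HasDim (SpanAll subspaces) (count (λ x → 1 ≤ᵇ count (ℬ x)))
    SpanAll-hasDim = Span-hasDim (λ x → 1 ≤ᵇ count (ℬ x)) ⊆covered covered⊆
      where
      ⊆covered : ∀ {v} → (∃ λ i → subspaces i v) → Coord (λ x → 1 ≤ᵇ count (ℬ x)) v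
      ⊆covered (i , lift v₀) = lift (λ a ¬1≤ → v₀ a (λ ℬai → ¬1≤ (≤⇒≤ᵇ (T⇒1≤count (ℬ a) i ℬai))))
      covered⊆ : ∀ a → T (1 ≤ᵇ count (ℬ a)) → ∃ λ i → subspaces i (e a)
      covered⊆ a 1≤ with 1≤count⇒∃ (ℬ a) (≤ᵇ⇒≤ 1 _ 1≤)
      ... | i , ℬai = i , e∈Coord (λ x → ℬ x i) ℬai

    SpanIntersections-hasDim : HasDim (SpanIntersections subspaces) (count (λ x → 2 ≤ᵇ count (ℬ x)))
    SpanIntersections-hasDim = Span-hasDim (λ x → 2 ≤ᵇ count (ℬ x)) ⊆covered covered⊆
      where
      ⊆covered : ∀ {v} → (∃ λ i → ∃ λ j → i ≢ j × (subspaces i ∩ subspaces j) v) →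
                 Coord (λ x → 2 ≤ᵇ count (ℬ x)) v
      ⊆covered (i , j , i≢j , lift vi , lift vj) = lift λ a ¬2≤ → case T? (ℬ a i) of λ
        { (yes ℬai) → vj a (λ ℬaj → ¬2≤ (≤⇒≤ᵇ (T×T⇒2≤count (ℬ a) i j i≢j ℬai ℬaj)))
        ; (no ¬ℬai) → vi a ¬ℬai }
      covered⊆ : ∀ a → T (2 ≤ᵇ count (ℬ a)) → ∃ λ i → ∃ λ j → i ≢ j × (subspaces i ∩ subspaces j) (e a)
      covered⊆ a 2≤ with 2≤count⇒∃ (ℬ a) (≤ᵇ⇒≤ 2 _ 2≤)
      ... | i , j , i≢j , ℬai , ℬaj = i , j , i≢j , e∈Coord (λ x → ℬ x i) ℬai , e∈Coord (λ x → ℬ x j) ℬaj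

    subspace-hasDim : ∀ i → HasDim (subspaces i) (degree ℬ i)
    subspace-hasDim i = Coord-hasDim (λ x → ℬ x i)

    subspace-∩-hasDim : ∀ i j → HasDim (subspaces i ∩ subspaces j) (codegree ℬ i j)
    subspace-∩-hasDim i j =
      HasDim-cong (Coord-∩ (λ x → ℬ x i) (λ x → ℬ x j)) (Coord-hasDim (λ x → ℬ x i ∧ ℬ x j))

    subspaces-distinct : ∀ i j → codegree ℬ i j < degree ℬ i → ¬ SameSet (subspaces i) (subspaces j)
    subspaces-distinct i j codeg<deg with count-∧<⇒∃ (λ x → ℬ x i) (λ x → ℬ x j) codeg<deg
    ... | a , ℬai , ¬ℬaj = Coord-distinct (λ x → ℬ x i) (λ x → ℬ x j) a ℬai ¬ℬaj

  balanced-isSCID : ∀ {n k t e} (ℬ : BalancedFamily n k (k ∸ t) e) → k ∸ t < k →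
                    IsSCIDFamily k t (subspaces (BalancedFamily.members ℬ))
  balanced-isSCID {k = k} {t} ℬ d<k = π-dim , π-meet
    where
    open BalancedFamily ℬ
    π-dim : ∀ i → IsSubspace (subspaces members i) × HasDim (subspaces members i) k
    π-dim i = Coord-isSubspace (λ x → members x i) ,
              subst (HasDim (subspaces members i)) (degree≡ i) (subspace-hasDim members i)
    π-meet : ∀ i j → i ≢ j → ¬ SameSet (subspaces members i) (subspaces members j) ×
                              HasDim (subspaces members i ∩ subspaces members j) (k ∸ t)
    π-meet i j i≢j =
      subspaces-distinct members i j (subst₂ _<_ (sym (codegree≡ i j i≢j)) (sym (degree≡ i)) d<k) ,
      subst (HasDim (subspaces members i ∩ subspaces members j)) (codegree≡ i j i≢j) (subspace-∩-hasDim members i j)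

≤∸1⇒< : ∀ {m n} → 1 ≤ m → m ≤ n ∸ 1 → m < n
≤∸1⇒< {n = zero}  1≤m m≤0 = ⊥-elim (<-irrefl refl (≤-trans 1≤m m≤0))
≤∸1⇒< {n = suc n} 1≤m m≤n = s≤s m≤n

theorem6 : ∀ {c ℓ : Level} (F : FiniteField c ℓ) (k t n ε η : ℕ) →
    0 < t → t ≤ k → (n ∸ 1) * (k ∸ t) ≤ k →
    ε ≤ k ∸ t → 2 ≤ η → η ≤ n ∸ 1 →
    let open LinearAlgebra F in
    ∃ λ (m : ℕ) → Σ (Fin n → VSet m) λ π →
      IsSCIDFamily k t π × 2 ≤ n ×
      ∃ λ dimS → ∃ λ dimI →
        HasDim (SpanAll π) dimS × HasDim (SpanIntersections π) dimI ×
        dimS + dimI + (η ∸ 2) * (k ∸ t) + ε ≡ n * k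
theorem6 F k t n ε η 0<t t≤k nd≤k ε≤d 2≤η η≤n∸1 =
  size , subspaces members , balanced-isSCID {t = t} ℬ (∸-monoʳ-< 0<t t≤k) ,
  ≤-trans 2≤η (≤-trans η≤n∸1 (m∸n≤m n 1)) ,
  _ , _ , SpanAll-hasDim members , SpanIntersections-hasDim members ,
  trans (+-assoc _ ((η ∸ 2) * (k ∸ t)) ε) (sizes-balanced ℬ)
  where
  open CoordinateSubspaces F
  ℬ : BalancedFamily n k (k ∸ t) ((η ∸ 2) * (k ∸ t) + ε)
  ℬ = balancedFamily 2≤η (≤∸1⇒< (≤-trans (s≤s z≤n) 2≤η) η≤n∸1) ε≤d nd≤k
  open BalancedFamily ℬ
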